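{- Let $\mathrm{G}$ be a finite metric space on the node set $V$ and let $v_0 \in V$. Then there exists a star metric $\mathrm{S}$ whose leaves are exactly the nodes of $V$, with edge weights $w_v \ge 0$ for the edge from the center to leaf $v$, such that: (1) $w(\mathrm{S}) = \sum_{v \in V} w_v$ equals $w(\mathrm{T}_{\mathrm{G}}(V))$, the weight of a minimum spanning tree of $\mathrm{G}$; (2) for every $V' \subseteq V$ with $v_0 \in V'$, we have $w(\mathrm{T}_{\mathrm{G}}(V')) \ge w_{\mathrm{S}}(V')$, where $w_{\mathrm{S}}(V') = \sum_{v \in V'} w_v$.
   Context: For a finite metric space $\mathrm{G}$ on node set $V$ with distance $w$ and a subset $V' \subseteq V$, $\mathrm{T}_{\mathrm{G}}(V')$ denotes a minimum-weight Steiner tree in $\mathrm{G}$ (viewed as the complete graph on $V$ with edge weights $w$) connecting all nodes of $V'$, and $w(\mathrm{T}_{\mathrm{G}}(V'))$ is its total edge weight; in particular $w(\mathrm{T}_{\mathrm{G}}(V))$ is the weight $\mathrm{MST}(\mathrm{G})$ of a minimum spanning tree. A star metric with leaves $V$ consists of a center $c$ and an edge of weight $w_v \ge 0$ from $c$ to each $v \in V$, the distance between leaves $u \ne v$ being $w_u + w_v$.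
   Formalization: The distances of the metric space G are rational, and the edge weights $w_v$ of the star metric S are taken in the rationals as well. -}

module Defs where

open import Data.Nat using (ℕ; zero; suc)
open import Data.Fin using (Fin)
import Data.Fin as F
open import Data.Bool using (Bool; true; false)
open import Data.Vec using (Vec; []; _∷_)
open import Data.List using (List; length)
open import Data.List.Membership.Propositional using () renaming (_∈_ to _∈ₗ_)
open import Data.List.Relation.Unary.All using (All)
open import Data.Product using (_×_; _,_; proj₁; proj₂; ∃-syntax)
open import Data.Sum using (_⊎_)
open import Data.Fin.Subset using (Subset; _∈_; _⊆_; ∣_∣; ⊤)
open import Data.Rational using (ℚ; 0ℚ; _+_; _≤_)
open import Relation.Binary.PropositionalEquality using (_≡_)
open import Relation.Nullary using (yes; no)

record IsMetric {n : ℕ} (d : Fin n → Fin n → ℚ) : Set where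
  field
    zero⇔eq  : ∀ x y → (d x y ≡ 0ℚ → x ≡ y) × (x ≡ y → d x y ≡ 0ℚ)
    symmetric : ∀ x y → d x y ≡ d y x
    triangle  : ∀ x y z → d x z ≤ d x y + d y z

Edge : ℕ → Set
Edge n = Fin n × Fin n

data Reach {n : ℕ} (E : List (Edge n)) : Fin n → Fin n → Set where
  here : ∀ {x} → Reach E x x
  step : ∀ {x y z} → ((x , y) ∈ₗ E ⊎ (y , x) ∈ₗ E) → Reach E y z → Reach E x z

record Tree (n : ℕ) : Set where
  field
    vertices  : Subset n
    edges     : List (Edge n)
    edgesIn   : All (λ e → proj₁ e ∈ vertices × proj₂ e ∈ vertices) edges
    connected : ∀ x y → x ∈ vertices → y ∈ vertices → Reach edges x y
    size      : suc (length edges) ≡ ∣ vertices ∣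
open Tree public

edgeSum : {n : ℕ} → (Fin n → Fin n → ℚ) → List (Edge n) → ℚ
edgeSum d List.[] = 0ℚ
edgeSum d ((u , v) List.∷ E) = d u v + edgeSum d E

treeWeight : {n : ℕ} → (Fin n → Fin n → ℚ) → Tree n → ℚ
treeWeight d T = edgeSum d (edges T)

SteinerTree : {n : ℕ} → Subset n → Tree n → Set
SteinerTree V' T = V' ⊆ vertices T

IsMinSteinerWeight : {n : ℕ} → (Fin n → Fin n → ℚ) → Subset n → ℚ → Set
IsMinSteinerWeight d V' x =
  (∃[ T ] (SteinerTree V' T × treeWeight d T ≡ x)) ×
  (∀ T → SteinerTree V' T → x ≤ treeWeight d T)

subsetWeight : {n : ℕ} → (Fin n → ℚ) → Subset n → ℚ
subsetWeight {zero} w [] = 0ℚ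
subsetWeight {suc n} w (true ∷ p) = w F.zero + subsetWeight (λ i → w (F.suc i)) p
subsetWeight {suc n} w (false ∷ p) = subsetWeight (λ i → w (F.suc i)) p

data StarNode (n : ℕ) : Set where
  center : StarNode n
  leaf   : Fin n → StarNode n

starDist : {n : ℕ} → (Fin n → ℚ) → StarNode n → StarNode n → ℚ
starDist w center center = 0ℚ
starDist w center (leaf v) = w v
starDist w (leaf v) center = w v
starDist w (leaf u) (leaf v) with u F.≟ v
... | yes _ = 0ℚ
... | no _ = w u + w v

starWeight : {n : ℕ} → (Fin n → ℚ) → ℚ
starWeight w = subsetWeight w ⊤

-- Grow a spanning tree from v₀ by Prim's algorithm and let w_u be the length of the edge by
-- which u gets attached, so that the tree weighs Σ_v w_v. For the lower bound, prove by induction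
-- on the number of vertices outside a stage S of the algorithm: if every vertex of W reaches S
-- through the edges E, then Σ_{v ∈ W} w_v ≤ w(E). When the next vertex u lies in W, its path to S
-- crosses the cut (S, V ∖ S) by an edge at least as long as w_u, because Prim picked a lightest
-- crossing edge; after deleting that edge every vertex of W still reaches S ∪ {u}, and the
-- induction hypothesis pays for the remaining edges. Taking S = {v₀} and E a Steiner tree gives
-- (2), and (2) for V' = V shows that the Prim tree is a minimum spanning tree.

module Submission where

open import Defs
open import Algebra.Bundles using (CommutativeMonoid)
open import Data.Fin using (Fin; zero; suc)
open import Data.Fin.Subset using (Subset; _∈_; _∉_; ⊤; _∪_; ⁅_⁆; ∣_∣; Nonempty; inside; outside)
open import Data.Fin.Subset.Properties
  using (_∈?_; ∈⊤; x∈⁅x⁆; x∈⁅y⁆⇒x≡y; ∣⁅x⁆∣≡1; ∣⊤∣≡n; ∣p∣≡n⇒p≡⊤; x∈p∪q⁻; ∪-identityʳ; drop-there; p⊆p∪q; q⊆p∪q)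
open import Data.List using (List; length; filter; cartesianProduct; allFin)
import Data.List as List
import Data.List.Extrema as Extrema
open import Data.List.Membership.Propositional using () renaming (_∈_ to _∈ₗ_)
open import Data.List.Membership.Propositional.Properties using (∈-filter⁺; ∈-cartesianProduct⁺; ∈-allFin)
import Data.List.Relation.Unary.All as All
open import Data.List.Relation.Unary.All.Properties using (all-filter)
open import Data.List.Relation.Unary.Any using (_─_) renaming (here to hereₗ; there to thereₗ)
open import Data.Nat using (ℕ)
import Data.Nat as ℕ
import Data.Nat.Properties as ℕ
open import Data.Product using (_×_; _,_; proj₂; ∃; ∃-syntax; uncurry) renaming (map to ×-map)
open import Data.Rational using (ℚ; 0ℚ; _+_; _≤_; _<_)
import Data.Rational.Properties as ℚ
open import Data.Sum using (_⊎_; inj₁; inj₂) renaming (swap to ⊎-swap; map to ⊎-map; map₂ to ⊎-map₂)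
open import Data.Vec using ([]; _∷_; here; there)
open import Function using (_∘_)
open import Relation.Binary.Bundles using (DecTotalOrder)
open import Relation.Binary.PropositionalEquality using (_≡_; refl; sym; trans; cong; subst; module ≡-Reasoning)
open import Relation.Nullary using (Dec; yes; no; contradiction)
open import Relation.Nullary.Decidable using (_×-dec_; ¬?)
open import Relation.Unary using (Decidable)

open import Algebra.Properties.CommutativeSemigroup
  (CommutativeMonoid.commutativeSemigroup ℚ.+-0-commutativeMonoid) using (interchange; x∙yz≈y∙xz)

private
  variable
    n : ℕ

dist-nonneg : ∀ {d : Fin n → Fin n → ℚ} → IsMetric d → ∀ x y → 0ℚ ≤ d x y
dist-nonneg {d = d} met x y = ℚ.≮⇒≥ (λ dxy<0 → ℚ.<-irrefl refl (0<0 dxy<0))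
  where
    open IsMetric met
    open ℚ.≤-Reasoning
    0<0 : d x y < 0ℚ → 0ℚ < 0ℚ
    0<0 dxy<0 = begin-strict
      0ℚ            ≡⟨ sym (proj₂ (zero⇔eq x x) refl) ⟩
      d x x         ≤⟨ triangle x y x ⟩
      d x y + d y x ≡⟨ cong (d x y +_) (symmetric y x) ⟩
      d x y + d x y <⟨ ℚ.+-mono-< dxy<0 dxy<0 ⟩
      0ℚ            ∎

∣p∪⁅x⁆∣≡1+∣p∣ : ∀ (p : Subset n) {x} → x ∉ p → ∣ p ∪ ⁅ x ⁆ ∣ ≡ ℕ.suc ∣ p ∣
∣p∪⁅x⁆∣≡1+∣p∣ (outside ∷ p) {zero}  _   = cong (ℕ.suc ∘ ∣_∣) (∪-identityʳ p)
∣p∪⁅x⁆∣≡1+∣p∣ (inside  ∷ p) {zero}  x∉p = contradiction here x∉p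
∣p∪⁅x⁆∣≡1+∣p∣ (outside ∷ p) {suc x} x∉p = ∣p∪⁅x⁆∣≡1+∣p∣ p (x∉p ∘ there)
∣p∪⁅x⁆∣≡1+∣p∣ (inside  ∷ p) {suc x} x∉p = cong ℕ.suc (∣p∪⁅x⁆∣≡1+∣p∣ p (x∉p ∘ there))

∣p∣<n⇒∃∉ : ∀ (p : Subset n) → ∣ p ∣ ℕ.< n → ∃[ x ] x ∉ p
∣p∣<n⇒∃∉ (outside ∷ p) _          = zero , λ ()
∣p∣<n⇒∃∉ (inside  ∷ p) (ℕ.s≤s lt) = ×-map suc (λ x∉p → x∉p ∘ drop-there) (∣p∣<n⇒∃∉ p lt)

pointMass : Fin n → ℚ → Fin n → ℚ
pointMass zero    δ zero    = δ
pointMass zero    δ (suc _) = 0ℚ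
pointMass (suc u) δ zero    = 0ℚ
pointMass (suc u) δ (suc v) = pointMass u δ v

pointMass-nonneg : ∀ {δ} → 0ℚ ≤ δ → ∀ (u v : Fin n) → 0ℚ ≤ pointMass u δ v
pointMass-nonneg 0≤δ zero    zero    = 0≤δ
pointMass-nonneg 0≤δ zero    (suc _) = ℚ.≤-refl
pointMass-nonneg 0≤δ (suc u) zero    = ℚ.≤-refl
pointMass-nonneg 0≤δ (suc u) (suc v) = pointMass-nonneg 0≤δ u v

subsetWeight-zero : ∀ (W : Subset n) → subsetWeight (λ _ → 0ℚ) W ≡ 0ℚ
subsetWeight-zero []            = refl
subsetWeight-zero (inside  ∷ W) = cong (0ℚ +_) (subsetWeight-zero W)
subsetWeight-zero (outside ∷ W) = subsetWeight-zero W

subsetWeight-+ : ∀ (f g : Fin n → ℚ) W →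
                 subsetWeight (λ v → f v + g v) W ≡ subsetWeight f W + subsetWeight g W
subsetWeight-+ f g []            = refl
subsetWeight-+ f g (inside  ∷ W) = begin
  (f zero + g zero) + subsetWeight (λ v → f (suc v) + g (suc v)) W
    ≡⟨ cong ((f zero + g zero) +_) (subsetWeight-+ (f ∘ suc) (g ∘ suc) W) ⟩
  (f zero + g zero) + (subsetWeight (f ∘ suc) W + subsetWeight (g ∘ suc) W)
    ≡⟨ interchange (f zero) (g zero) _ _ ⟩
  (f zero + subsetWeight (f ∘ suc) W) + (g zero + subsetWeight (g ∘ suc) W) ∎
  where open ≡-Reasoning
subsetWeight-+ f g (outside ∷ W) = subsetWeight-+ (f ∘ suc) (g ∘ suc) W

subsetWeight-pointMass-∈ : ∀ (W : Subset n) {u} δ → u ∈ W → subsetWeight (pointMass u δ) W ≡ δ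
subsetWeight-pointMass-∈ (inside  ∷ W) {zero}  δ here      =
  trans (cong (δ +_) (subsetWeight-zero W)) (ℚ.+-identityʳ δ)
subsetWeight-pointMass-∈ (inside  ∷ W) {suc u} δ (there m) =
  trans (ℚ.+-identityˡ _) (subsetWeight-pointMass-∈ W δ m)
subsetWeight-pointMass-∈ (outside ∷ W) {suc u} δ (there m) = subsetWeight-pointMass-∈ W δ m

subsetWeight-pointMass-∉ : ∀ (W : Subset n) {u} δ → u ∉ W → subsetWeight (pointMass u δ) W ≡ 0ℚ
subsetWeight-pointMass-∉ []            δ u∉W = refl
subsetWeight-pointMass-∉ (inside  ∷ W) {zero}  δ u∉W = contradiction here u∉W
subsetWeight-pointMass-∉ (outside ∷ W) {zero}  δ u∉W = subsetWeight-zero W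
subsetWeight-pointMass-∉ (inside  ∷ W) {suc u} δ u∉W =
  trans (ℚ.+-identityˡ _) (subsetWeight-pointMass-∉ W δ (u∉W ∘ there))
subsetWeight-pointMass-∉ (outside ∷ W) {suc u} δ u∉W = subsetWeight-pointMass-∉ W δ (u∉W ∘ there)

∈-─ : ∀ {A : Set} {x y : A} {xs} (p : x ∈ₗ xs) → y ∈ₗ xs → y ≡ x ⊎ y ∈ₗ (xs ─ p)
∈-─ (hereₗ refl) (hereₗ y≡x) = inj₁ y≡x
∈-─ (hereₗ refl) (thereₗ q)  = inj₂ q
∈-─ (thereₗ p)   (hereₗ y≡z) = inj₂ (hereₗ y≡z)
∈-─ (thereₗ p)   (thereₗ q)  = ⊎-map₂ thereₗ (∈-─ p q)

edgeSum-─ : ∀ (d : Fin n → Fin n → ℚ) {a b E} (p : (a , b) ∈ₗ E) →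
            edgeSum d E ≡ d a b + edgeSum d (E ─ p)
edgeSum-─ d (hereₗ refl) = refl
edgeSum-─ d {a} {b} {(x , y) List.∷ E} (thereₗ p) =
  trans (cong (d x y +_) (edgeSum-─ d p)) (x∙yz≈y∙xz (d x y) (d a b) _)

edgeSum-nonneg : ∀ (d : Fin n → Fin n → ℚ) → (∀ x y → 0ℚ ≤ d x y) → ∀ E → 0ℚ ≤ edgeSum d E
edgeSum-nonneg d d≥0 List.[]             = ℚ.≤-refl
edgeSum-nonneg d d≥0 ((x , y) List.∷ E) = ℚ.+-mono-≤ (d≥0 x y) (edgeSum-nonneg d d≥0 E)

Link : List (Edge n) → Fin n → Fin n → Set
Link E x y = (x , y) ∈ₗ E ⊎ (y , x) ∈ₗ E

_∖_ : ∀ (E : List (Edge n)) {a b} → Link E a b → List (Edge n)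
E ∖ inj₁ p = E ─ p
E ∖ inj₂ p = E ─ p

edgeSum-∖ : ∀ (d : Fin n → Fin n → ℚ) → (∀ x y → d x y ≡ d y x) →
            ∀ {E a b} (l : Link E a b) → edgeSum d E ≡ d a b + edgeSum d (E ∖ l)
edgeSum-∖ d d-sym (inj₁ p)         = edgeSum-─ d p
edgeSum-∖ d d-sym {a = a} {b} (inj₂ p) = trans (edgeSum-─ d p) (cong (_+ edgeSum d (_ ─ p)) (d-sym b a))

link-∖ : ∀ {E : List (Edge n)} {a b x y} (l : Link E a b) → Link E x y →
         (x ≡ a × y ≡ b) ⊎ (x ≡ b × y ≡ a) ⊎ Link (E ∖ l) x y
link-∖ (inj₁ p) (inj₁ q) with ∈-─ p q
... | inj₁ refl = inj₁ (refl , refl)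
... | inj₂ q′   = inj₂ (inj₂ (inj₁ q′))
link-∖ (inj₁ p) (inj₂ q) with ∈-─ p q
... | inj₁ refl = inj₂ (inj₁ (refl , refl))
... | inj₂ q′   = inj₂ (inj₂ (inj₂ q′))
link-∖ (inj₂ p) (inj₁ q) with ∈-─ p q
... | inj₁ refl = inj₂ (inj₁ (refl , refl))
... | inj₂ q′   = inj₂ (inj₂ (inj₁ q′))
link-∖ (inj₂ p) (inj₂ q) with ∈-─ p q
... | inj₁ refl = inj₁ (refl , refl)
... | inj₂ q′   = inj₂ (inj₂ (inj₂ q′))

Reach-trans : ∀ {E : List (Edge n)} {x y z} → Reach E x y → Reach E y z → Reach E x z
Reach-trans here       q = q
Reach-trans (step l p) q = step l (Reach-trans p q)

Reach-sym : ∀ {E : List (Edge n)} {x y} → Reach E x y → Reach E y x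
Reach-sym here       = here
Reach-sym (step l p) = Reach-trans (Reach-sym p) (step (⊎-swap l) here)

Reach-∷ : ∀ {E : List (Edge n)} {e x y} → Reach E x y → Reach (e List.∷ E) x y
Reach-∷ here       = here
Reach-∷ (step l p) = step (⊎-map thereₗ thereₗ l) (Reach-∷ p)

spanningTree : ∀ (F : List (Edge n)) r → (∀ v → Reach F v r) → ℕ.suc (length F) ≡ n → Tree n
spanningTree {n} F r ⇝r size = record
  { vertices  = ⊤
  ; edges     = F
  ; edgesIn   = All.tabulate (λ _ → ∈⊤ , ∈⊤)
  ; connected = λ x y _ _ → Reach-trans (⇝r x) (Reach-sym (⇝r y))
  ; size      = trans size (sym (∣⊤∣≡n n))
  }

ReachSet : List (Edge n) → Fin n → Subset n → Set
ReachSet E v S = ∃[ s ] (s ∈ S × Reach E v s)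

reachSet-step : ∀ {E : List (Edge n)} {S v y} → Link E v y → ReachSet E y S → ReachSet E v S
reachSet-step l (s , s∈S , p) = s , s∈S , step l p

reachSet-⊆ : ∀ {E : List (Edge n)} {S T v} → (∀ {x} → x ∈ S → x ∈ T) → ReachSet E v S → ReachSet E v T
reachSet-⊆ S⊆T (s , s∈S , p) = s , S⊆T s∈S , p

reachSet-∷ : ∀ {E : List (Edge n)} {e S v} → ReachSet E v S → ReachSet (e List.∷ E) v S
reachSet-∷ (s , s∈S , p) = s , s∈S , Reach-∷ p

reachSet-∪⁅⁆ : ∀ {E : List (Edge n)} {S s u v} → s ∈ S → Link E u s →
               ReachSet E v (S ∪ ⁅ u ⁆) → ReachSet E v S
reachSet-∪⁅⁆ {S = S} {s} {u} s∈S l (t , t∈S∪u , p) with x∈p∪q⁻ S ⁅ u ⁆ t∈S∪u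
... | inj₁ t∈S = t , t∈S , p
... | inj₂ t∈u = s , s∈S , Reach-trans p (subst (λ t → Reach _ t s) (sym (x∈⁅y⁆⇒x≡y u t∈u)) (step l here))

reachSet-⁅⁆ : ∀ {E : List (Edge n)} {v r} → ReachSet E v ⁅ r ⁆ → Reach E v r
reachSet-⁅⁆ {r = r} (t , t∈r , p) = subst (Reach _ _) (x∈⁅y⁆⇒x≡y r t∈r) p

reachSet-∖ : ∀ {E : List (Edge n)} {T a b} (l : Link E a b) →
             ReachSet (E ∖ l) a T → ReachSet (E ∖ l) b T →
             ∀ {v s} → s ∈ T → Reach E v s → ReachSet (E ∖ l) v T
reachSet-∖ l ra rb s∈T here = _ , s∈T , here
reachSet-∖ l ra rb s∈T (step l′ p) with link-∖ l l′
... | inj₁ (refl , _)        = ra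
... | inj₂ (inj₁ (refl , _)) = rb
... | inj₂ (inj₂ l″)         = reachSet-step l″ (reachSet-∖ l ra rb s∈T p)

record CrossingLink (E : List (Edge n)) (S : Subset n) (v : Fin n) : Set where
  field
    inner outer : Fin n
    inner∈S     : inner ∈ S
    outer∉S     : outer ∉ S
    link        : Link E inner outer
    path        : Reach (E ∖ link) v outer

crossingLink : ∀ {E : List (Edge n)} {S v s} → v ∉ S → s ∈ S → Reach E v s → CrossingLink E S v
crossingLink v∉S s∈S here = contradiction s∈S v∉S
crossingLink {S = S} {v} v∉S s∈S (step {y = y} l p) with y ∈? S
... | yes y∈S = record
  { inner = y ; outer = v ; inner∈S = y∈S ; outer∉S = v∉S ; link = ⊎-swap l ; path = here }
... | no y∉S = record
  { inner = inner ; outer = outer ; inner∈S = inner∈S ; outer∉S = outer∉S ; link = link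
  ; path = step kept path }
  where
    open CrossingLink (crossingLink y∉S s∈S p)
    kept : Link (_ ∖ link) v y
    kept with link-∖ link l
    ... | inj₁ (v≡inner , _)        = contradiction (subst (_∈ S) (sym v≡inner) inner∈S) v∉S
    ... | inj₂ (inj₁ (_ , y≡inner)) = contradiction (subst (_∈ S) (sym y≡inner) inner∈S) y∉S
    ... | inj₂ (inj₂ l′)            = l′

Crossing : Subset n → Edge n → Set
Crossing S (a , b) = a ∈ S × b ∉ S

crossing? : ∀ (S : Subset n) → Decidable (Crossing S)
crossing? S (a , b) = a ∈? S ×-dec ¬? (b ∈? S)

LightestCrossing : (Edge n → ℚ) → Subset n → Edge n → Set
LightestCrossing f S e = Crossing S e × (∀ e′ → Crossing S e′ → f e ≤ f e′)

lightestCrossing : ∀ (f : Edge n → ℚ) (S : Subset n) → ∃ (Crossing S) → ∃ (LightestCrossing f S)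
lightestCrossing {n} f S (e₀ , e₀-crossing) =
  argmin f e₀ crossings ,
  argmin-all f e₀-crossing (all-filter (crossing? S) allEdges) ,
  λ { (a , b) crossing → All.lookup (f[argmin]≤f[xs] e₀ crossings)
        (∈-filter⁺ (crossing? S) (∈-cartesianProduct⁺ (∈-allFin a) (∈-allFin b)) crossing) }
  where
    open Extrema (DecTotalOrder.totalOrder ℚ.≤-decTotalOrder)
    allEdges crossings : List (Edge n)
    allEdges  = cartesianProduct (allFin n) (allFin n)
    crossings = filter (crossing? S) allEdges

module Prim {n} (d : Fin n → Fin n → ℚ) (d-sym : ∀ x y → d x y ≡ d y x) (d-nonneg : ∀ x y → 0ℚ ≤ d x y) where

  SteinerLowerBound : Subset n → (Fin n → ℚ) → Set
  SteinerLowerBound S w =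
    ∀ W E → (∀ {v} → v ∈ W → ReachSet E v S) → subsetWeight w W ≤ edgeSum d E

  steinerLowerBound-zero : ∀ S → SteinerLowerBound S (λ _ → 0ℚ)
  steinerLowerBound-zero S W E _ =
    subst (_≤ edgeSum d E) (sym (subsetWeight-zero W)) (edgeSum-nonneg d d-nonneg E)

  steinerLowerBound-extend :
    ∀ {S w s u} → LightestCrossing (uncurry d) S (s , u) →
    SteinerLowerBound (S ∪ ⁅ u ⁆) w → SteinerLowerBound S (λ v → w v + pointMass u (d s u) v)
  steinerLowerBound-extend {S} {w} {s} {u} ((s∈S , u∉S) , lightest) bound W E W⇝S = begin
    subsetWeight (λ v → w v + pointMass u (d s u) v) W
      ≡⟨ subsetWeight-+ w (pointMass u (d s u)) W ⟩
    subsetWeight w W + subsetWeight (pointMass u (d s u)) W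
      ≤⟨ bound+pointMass (u ∈? W) ⟩
    edgeSum d E ∎
    where
      open ℚ.≤-Reasoning
      S⊆S∪u : ∀ {x} → x ∈ S → x ∈ S ∪ ⁅ u ⁆
      S⊆S∪u = p⊆p∪q ⁅ u ⁆
      bound+pointMass : Dec (u ∈ W) → subsetWeight w W + subsetWeight (pointMass u (d s u)) W ≤ edgeSum d E
      bound+pointMass (no u∉W) = begin
        subsetWeight w W + subsetWeight (pointMass u (d s u)) W
          ≡⟨ cong (subsetWeight w W +_) (subsetWeight-pointMass-∉ W _ u∉W) ⟩
        subsetWeight w W + 0ℚ
          ≡⟨ ℚ.+-identityʳ _ ⟩
        subsetWeight w W
          ≤⟨ bound W E (reachSet-⊆ S⊆S∪u ∘ W⇝S) ⟩
        edgeSum d E ∎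
      bound+pointMass (yes u∈W) with W⇝S u∈W
      ... | _ , s′∈S , u⇝s′ = begin
        subsetWeight w W + subsetWeight (pointMass u (d s u)) W
          ≡⟨ cong (subsetWeight w W +_) (subsetWeight-pointMass-∈ W _ u∈W) ⟩
        subsetWeight w W + d s u
          ≤⟨ ℚ.+-mono-≤ (bound W (E ∖ link) W⇝S∪u) (lightest (inner , outer) (inner∈S , outer∉S)) ⟩
        edgeSum d (E ∖ link) + d inner outer
          ≡⟨ ℚ.+-comm (edgeSum d (E ∖ link)) (d inner outer) ⟩
        d inner outer + edgeSum d (E ∖ link)
          ≡⟨ edgeSum-∖ d d-sym link ⟨
        edgeSum d E ∎
        where
          open CrossingLink (crossingLink u∉S s′∈S u⇝s′)
          W⇝S∪u : ∀ {v} → v ∈ W → ReachSet (E ∖ link) v (S ∪ ⁅ u ⁆)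
          W⇝S∪u v∈W =
            let t , t∈S , v⇝t = W⇝S v∈W
            in reachSet-∖ link (inner , S⊆S∪u inner∈S , here) (u , q⊆p∪q S ⁅ u ⁆ (x∈⁅x⁆ u) , Reach-sym path)
                          (S⊆S∪u t∈S) v⇝t

  record Run (S : Subset n) : Set where
    field
      weight         : Fin n → ℚ
      weight-nonneg  : ∀ v → 0ℚ ≤ weight v
      weight-bound   : SteinerLowerBound S weight
      forest         : List (Edge n)
      forest-reaches : ∀ v → ReachSet forest v S
      forest-size    : ∣ S ∣ ℕ.+ length forest ≡ n
      forest-weight  : edgeSum d forest ≡ subsetWeight weight ⊤

  run-full : ∀ S → ∣ S ∣ ℕ.+ 0 ≡ n → Run S
  run-full S size = record
    { weight         = λ _ → 0ℚ
    ; weight-nonneg  = λ _ → ℚ.≤-refl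
    ; weight-bound   = steinerLowerBound-zero S
    ; forest         = List.[]
    ; forest-reaches = λ v → v , subst (v ∈_) (sym (∣p∣≡n⇒p≡⊤ (trans (sym (ℕ.+-identityʳ ∣ S ∣)) size))) ∈⊤ , here
    ; forest-size    = size
    ; forest-weight  = sym (subsetWeight-zero (⊤ {n}))
    }

  run-extend : ∀ {S s u} → LightestCrossing (uncurry d) S (s , u) → Run (S ∪ ⁅ u ⁆) → Run S
  run-extend {S} {s} {u} lightest@((s∈S , u∉S) , _) R = record
    { weight         = weight′
    ; weight-nonneg  = λ v → ℚ.+-mono-≤ (weight-nonneg v) (pointMass-nonneg (d-nonneg s u) u v)
    ; weight-bound   = steinerLowerBound-extend lightest weight-bound
    ; forest         = (s , u) List.∷ forest
    ; forest-reaches = λ v → reachSet-∪⁅⁆ s∈S (inj₂ (hereₗ refl)) (reachSet-∷ (forest-reaches v))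
    ; forest-size    = begin
        ∣ S ∣ ℕ.+ ℕ.suc (length forest)   ≡⟨ ℕ.+-suc ∣ S ∣ (length forest) ⟩
        ℕ.suc ∣ S ∣ ℕ.+ length forest     ≡⟨ cong (ℕ._+ length forest) (∣p∪⁅x⁆∣≡1+∣p∣ S u∉S) ⟨
        ∣ S ∪ ⁅ u ⁆ ∣ ℕ.+ length forest   ≡⟨ forest-size ⟩
        n                                 ∎
    ; forest-weight  = begin
        d s u + edgeSum d forest
          ≡⟨ cong (d s u +_) forest-weight ⟩
        d s u + subsetWeight weight ⊤
          ≡⟨ ℚ.+-comm (d s u) _ ⟩
        subsetWeight weight ⊤ + d s u
          ≡⟨ cong (subsetWeight weight ⊤ +_) (subsetWeight-pointMass-∈ (⊤ {n}) {u} _ ∈⊤) ⟨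
        subsetWeight weight ⊤ + subsetWeight (pointMass u (d s u)) ⊤
          ≡⟨ subsetWeight-+ weight (pointMass u (d s u)) ⊤ ⟨
        subsetWeight weight′ ⊤ ∎
    }
    where
      open Run R
      open ≡-Reasoning
      weight′ : Fin n → ℚ
      weight′ v = weight v + pointMass u (d s u) v

  run : ∀ k S → ∣ S ∣ ℕ.+ k ≡ n → Nonempty S → Run S
  run ℕ.zero    S size _ = run-full S size
  run (ℕ.suc k) S size (s₀ , s₀∈S)
    with ∣p∣<n⇒∃∉ S (subst (∣ S ∣ ℕ.<_) size (ℕ.m<m+n ∣ S ∣ ℕ.z<s))
  ... | u₀ , u₀∉S with lightestCrossing (uncurry d) S ((s₀ , u₀) , s₀∈S , u₀∉S)
  ... | (s , u) , lightest@((_ , u∉S) , _) =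
    run-extend lightest (run k (S ∪ ⁅ u ⁆) size′ (s₀ , p⊆p∪q ⁅ u ⁆ s₀∈S))
    where
      size′ : ∣ S ∪ ⁅ u ⁆ ∣ ℕ.+ k ≡ n
      size′ = trans (cong (ℕ._+ k) (∣p∪⁅x⁆∣≡1+∣p∣ S u∉S)) (trans (sym (ℕ.+-suc ∣ S ∣ k)) size)

theorem2 : (n : ℕ) (d : Fin n → Fin n → ℚ) → IsMetric d → (v₀ : Fin n) →
    ∃[ w ] ((∀ v → 0ℚ ≤ w v) ×
            IsMinSteinerWeight d ⊤ (starWeight w) ×
            (∀ (V' : Subset n) → v₀ ∈ V' → ∀ (T : Tree n) → SteinerTree V' T →
               subsetWeight w V' ≤ treeWeight d T))
theorem2 (ℕ.suc m) d met v₀ =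
  weight , weight-nonneg , ((mst , (λ _ → ∈⊤) , forest-weight) , (λ T → steiner ⊤ ∈⊤ T)) , steiner
  where
    open Prim d (IsMetric.symmetric met) (dist-nonneg met)
    open Run (run m ⁅ v₀ ⁆ (cong (ℕ._+ m) (∣⁅x⁆∣≡1 v₀)) (v₀ , x∈⁅x⁆ v₀))
    steiner : ∀ V' → v₀ ∈ V' → ∀ T → SteinerTree V' T → subsetWeight weight V' ≤ treeWeight d T
    steiner V' v₀∈V' T V'⊆T = weight-bound V' (edges T)
      (λ v∈V' → v₀ , x∈⁅x⁆ v₀ , connected T _ v₀ (V'⊆T v∈V') (V'⊆T v₀∈V'))
    mst : Tree (ℕ.suc m)
    mst = spanningTree forest v₀ (reachSet-⁅⁆ ∘ forest-reaches)
      (trans (cong (ℕ._+ length forest) (sym (∣⁅x⁆∣≡1 v₀))) forest-size)
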